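{- Let $E_1,E_2$ be propositional variables and let $\varphi=(E_1\veebar E_2)\wedge\big(E_1\rightarrow\bigwedge_{0\le i<10}\neg K^iE_1\big)\wedge\big(E_2\rightarrow(\bigwedge_{0\le i<20}\neg K^iE_2\wedge\bigwedge_{10<i\le20}K^i\neg E_1)\big)$, where $\veebar$ is exclusive disjunction. Then $K^1\varphi\vdash_{\mathsf{tS4}}\bot$.
   Context: The timed modal epistemic language has formulas $A::= p\mid\bot\mid\neg A\mid A\wedge A\mid A\vee A\mid A\rightarrow A\mid K^iA$ for non-negative integers $i$. The logic $\mathsf{tK}$ has axioms: all propositional tautologies; tK: $K^i(A\rightarrow B)\rightarrow(K^jA\rightarrow K^kB)$ for $i,j<k$; Mon: $K^iA\rightarrow K^jA$ for $i<j$; and rules Modus Ponens, Deduction by Epistemization (from $\vdash A$ infer $\vdash K^iA\rightarrow K^jK^iA$, for $i<j$) and Epistemization (from $\vdash A$ infer $\vdash K^iA$). $\mathsf{tT}$ adds the axiom $K^iA\rightarrow A$, and $\mathsf{tS4}$ further adds $K^iA\rightarrow K^jK^iA$ for $i<j$. $\Gamma\vdash_{\mathsf{tS4}}B$ means $B$ is derivable from the premises $\Gamma$ and theorems of $\mathsf{tS4}$ by Modus Ponens (the two epistemization rules apply only to theorems), so that the deduction theorem holds. -}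

module Defs where

open import Data.Nat using (ℕ; zero; suc; _+_; _<_)
open import Data.Bool using (Bool; true; false; not; _∧_; _∨_)
open import Data.List using (List; []; _∷_; map; upTo)
open import Data.List.Membership.Propositional using (_∈_)
open import Relation.Binary.PropositionalEquality using (_≡_)

infixr 5 _⇒_
infixr 6 _∨′_
infixr 7 _∧′_

data Fm : Set where
  var  : ℕ → Fm
  ⊥′   : Fm
  ¬′_  : Fm → Fm
  _∧′_ : Fm → Fm → Fm
  _∨′_ : Fm → Fm → Fm
  _⇒_  : Fm → Fm → Fm
  K    : ℕ → Fm → Fm

⟦_⟧ : Fm → (Fm → Bool) → Bool
⟦ var n ⟧ v = v (var n)
⟦ ⊥′ ⟧ v = false
⟦ ¬′ A ⟧ v = not (⟦ A ⟧ v)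
⟦ A ∧′ B ⟧ v = ⟦ A ⟧ v ∧ ⟦ B ⟧ v
⟦ A ∨′ B ⟧ v = ⟦ A ⟧ v ∨ ⟦ B ⟧ v
⟦ A ⇒ B ⟧ v = not (⟦ A ⟧ v) ∨ ⟦ B ⟧ v
⟦ K i A ⟧ v = v (K i A)

-- A (substitution instance of a) propositional tautology.
Tautology : Fm → Set
Tautology A = ∀ (v : Fm → Bool) → ⟦ A ⟧ v ≡ true

data ⊢tS4_ : Fm → Set where
  taut : ∀ {A} → Tautology A → ⊢tS4 A
  axK  : ∀ {i j k A B} → i < k → j < k → ⊢tS4 (K i (A ⇒ B) ⇒ (K j A ⇒ K k B))
  mon  : ∀ {i j A} → i < j → ⊢tS4 (K i A ⇒ K j A)
  axT  : ∀ {i A} → ⊢tS4 (K i A ⇒ A)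
  ax4  : ∀ {i j A} → i < j → ⊢tS4 (K i A ⇒ K j (K i A))
  mp   : ∀ {A B} → ⊢tS4 (A ⇒ B) → ⊢tS4 A → ⊢tS4 B
  de   : ∀ {i j A} → i < j → ⊢tS4 A → ⊢tS4 (K i A ⇒ K j (K i A))
  epi  : ∀ {i A} → ⊢tS4 A → ⊢tS4 (K i A)

data _⊢tS4_ (Γ : List Fm) : Fm → Set where
  thm : ∀ {A} → ⊢tS4 A → Γ ⊢tS4 A
  hyp : ∀ {A} → A ∈ Γ → Γ ⊢tS4 A
  mp  : ∀ {A B} → Γ ⊢tS4 (A ⇒ B) → Γ ⊢tS4 A → Γ ⊢tS4 B

_⊻_ : Fm → Fm → Fm
A ⊻ B = (A ∨′ B) ∧′ ¬′ (A ∧′ B)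

⋀ : List Fm → Fm
⋀ [] = ¬′ ⊥′
⋀ (A ∷ []) = A
⋀ (A ∷ As) = A ∧′ ⋀ As

φ : Fm → Fm → Fm
φ E₁ E₂ =
  (E₁ ⊻ E₂)
  ∧′ (E₁ ⇒ ⋀ (map (λ i → ¬′ K i E₁) (upTo 10)))
  ∧′ (E₂ ⇒ (⋀ (map (λ i → ¬′ K i E₂) (upTo 20))
            ∧′ ⋀ (map (λ i → K i (¬′ E₁)) (map (11 +_) (upTo 10)))))

module Submission where

-- Write H = K¹φ.  Knowledge of φ at time 1 yields, by timed
-- necessitation, K²(¬E₁ → E₂) and K²(¬E₂ → E₁).  If E₂ held, φ would give
-- K¹¹¬E₁, hence K¹²E₂ by the first of these, contradicting the clause
-- ¬K¹²E₂ of φ; so H proves ¬E₂.  Since H is itself a piece of knowledge,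
-- positive introspection lets H know what it proves: H ⊢ K³¬E₂, and with
-- K²(¬E₂ → E₁) this gives K⁴E₁.  But from ¬E₂ the exclusive disjunction gives
-- E₁, and then φ demands ¬K⁴E₁: a contradiction.

open import Defs
open import Data.Nat using (ℕ; zero; suc; _+_; _<_; _<ᵇ_; s≤s; z≤n)
open import Data.Nat.Properties using (<ᵇ⇒<; n<1+n)
open import Data.Bool using (Bool; true; false; not; _∧_; _∨_; T)
open import Data.Bool.Properties using (T-≡; T-∧)
open import Data.Product using (proj₁; proj₂)
open import Data.List using ([]; _∷_; map; upTo)
open import Data.List.Membership.Propositional using (_∈_)
open import Data.List.Membership.Propositional.Properties using (∈-map⁺; ∈-upTo⁺)
open import Data.List.Relation.Unary.Any using (here; there)
open import Function.Bundles using (Equivalence)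
open import Relation.Binary.PropositionalEquality using (_≡_; _≢_; refl)

BoolFn : ℕ → Set
BoolFn zero    = Bool
BoolFn (suc n) = Bool → BoolFn n

valid? : (n : ℕ) → BoolFn n → Bool
valid? zero    b = b
valid? (suc n) f = valid? n (f true) ∧ valid? n (f false)

Valid : (n : ℕ) → BoolFn n → Set
Valid zero    b = b ≡ true
Valid (suc n) f = (a : Bool) → Valid n (f a)

truth-table : (n : ℕ) (f : BoolFn n) → T (valid? n f) → Valid n f
truth-table zero    b ok       = Equivalence.to T-≡ ok
truth-table (suc n) f ok true  =
  truth-table n (f true) (proj₁ (Equivalence.to (T-∧ {valid? n (f true)}) ok))
truth-table (suc n) f ok false =
  truth-table n (f false) (proj₂ (Equivalence.to (T-∧ {valid? n (f true)}) ok))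

infixr 5 _→ᵇ_
_→ᵇ_ : Bool → Bool → Bool
a →ᵇ b = not a ∨ b

<-by-computation : ∀ {m n} → {T (m <ᵇ n)} → m < n
<-by-computation {m} {n} {m<n} = <ᵇ⇒< m n m<n

⇒-refl : ∀ {A} → ⊢tS4 (A ⇒ A)
⇒-refl {A} = taut λ v → truth-table 1 (λ a → a →ᵇ a) _ (⟦ A ⟧ v)

⇒-weaken : ∀ {A H} → ⊢tS4 (A ⇒ (H ⇒ A))
⇒-weaken {A} {H} = taut λ v →
  truth-table 2 (λ a h → a →ᵇ h →ᵇ a) _ (⟦ A ⟧ v) (⟦ H ⟧ v)

⇒-trans : ∀ {A B C} → ⊢tS4 ((A ⇒ B) ⇒ ((B ⇒ C) ⇒ (A ⇒ C)))
⇒-trans {A} {B} {C} = taut λ v →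
  truth-table 3 (λ a b c → (a →ᵇ b) →ᵇ (b →ᵇ c) →ᵇ a →ᵇ c) _
    (⟦ A ⟧ v) (⟦ B ⟧ v) (⟦ C ⟧ v)

⇒-dist : ∀ {H A B} → ⊢tS4 ((H ⇒ (A ⇒ B)) ⇒ ((H ⇒ A) ⇒ (H ⇒ B)))
⇒-dist {H} {A} {B} = taut λ v →
  truth-table 3 (λ h a b → (h →ᵇ a →ᵇ b) →ᵇ (h →ᵇ a) →ᵇ h →ᵇ b) _
    (⟦ H ⟧ v) (⟦ A ⟧ v) (⟦ B ⟧ v)

∧-fst : ∀ {A B} → ⊢tS4 ((A ∧′ B) ⇒ A)
∧-fst {A} {B} = taut λ v →
  truth-table 2 (λ a b → (a ∧ b) →ᵇ a) _ (⟦ A ⟧ v) (⟦ B ⟧ v)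

∧-snd : ∀ {A B} → ⊢tS4 ((A ∧′ B) ⇒ B)
∧-snd {A} {B} = taut λ v →
  truth-table 2 (λ a b → (a ∧ b) →ᵇ b) _ (⟦ A ⟧ v) (⟦ B ⟧ v)

⊻-resolveˡ : ∀ {A B} → ⊢tS4 ((A ⊻ B) ⇒ (¬′ A ⇒ B))
⊻-resolveˡ {A} {B} = taut λ v →
  truth-table 2 (λ a b → ((a ∨ b) ∧ not (a ∧ b)) →ᵇ not a →ᵇ b) _
    (⟦ A ⟧ v) (⟦ B ⟧ v)

⊻-resolveʳ : ∀ {A B} → ⊢tS4 ((A ⊻ B) ⇒ (¬′ B ⇒ A))
⊻-resolveʳ {A} {B} = taut λ v →
  truth-table 2 (λ a b → ((a ∨ b) ∧ not (a ∧ b)) →ᵇ not b →ᵇ a) _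
    (⟦ A ⟧ v) (⟦ B ⟧ v)

reductio : ∀ {A B} → ⊢tS4 ((A ⇒ B) ⇒ ((A ⇒ ¬′ B) ⇒ ¬′ A))
reductio {A} {B} = taut λ v →
  truth-table 2 (λ a b → (a →ᵇ b) →ᵇ (a →ᵇ not b) →ᵇ not a) _
    (⟦ A ⟧ v) (⟦ B ⟧ v)

noncontradiction : ∀ {A} → ⊢tS4 (A ⇒ (¬′ A ⇒ ⊥′))
noncontradiction {A} = taut λ v →
  truth-table 1 (λ a → a →ᵇ not a →ᵇ false) _ (⟦ A ⟧ v)

-- Derived rules.  A theorem H ⇒ A is read as "A holds under hypothesis H";
-- the rules below are the usual closure properties of such facts.
infixl 4 _⨾_ _⊛_

_⨾_ : ∀ {A B C} → ⊢tS4 (A ⇒ B) → ⊢tS4 (B ⇒ C) → ⊢tS4 (A ⇒ C)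
f ⨾ g = mp (mp ⇒-trans f) g

_⊛_ : ∀ {H A B} → ⊢tS4 (H ⇒ (A ⇒ B)) → ⊢tS4 (H ⇒ A) → ⊢tS4 (H ⇒ B)
f ⊛ g = mp (mp ⇒-dist f) g

weaken : ∀ {H A} → ⊢tS4 A → ⊢tS4 (H ⇒ A)
weaken a = mp ⇒-weaken a

chain : ∀ {H A B C} → ⊢tS4 (H ⇒ (A ⇒ B)) → ⊢tS4 (H ⇒ (B ⇒ C)) →
        ⊢tS4 (H ⇒ (A ⇒ C))
chain f g = (f ⨾ ⇒-trans) ⊛ g

refute : ∀ {H A B} → ⊢tS4 (H ⇒ (A ⇒ B)) → ⊢tS4 (H ⇒ (A ⇒ ¬′ B)) →
         ⊢tS4 (H ⇒ ¬′ A)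
refute f g = (f ⨾ reductio) ⊛ g

clash : ∀ {H A} → ⊢tS4 (H ⇒ A) → ⊢tS4 (H ⇒ ¬′ A) → ⊢tS4 (H ⇒ ⊥′)
clash f g = (f ⨾ noncontradiction) ⊛ g

⋀-elim : ∀ {A As} → A ∈ As → ⊢tS4 (⋀ As ⇒ A)
⋀-elim {As = _ ∷ []}    (here refl) = ⇒-refl
⋀-elim {As = _ ∷ _ ∷ _} (here refl) = ∧-fst
⋀-elim {As = _ ∷ _ ∷ _} (there A∈) = ∧-snd ⨾ ⋀-elim A∈

-- Timed necessitation: a theorem A ⇒ B transfers knowledge of A at time i to
-- knowledge of B at any later time j (Epistemization at time 0, then tK).
K-mono : ∀ {i j A B} → ⊢tS4 (A ⇒ B) → i < j → ⊢tS4 (K i A ⇒ K j B)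
K-mono f i<j@(s≤s _) = mp (axK (s≤s z≤n) i<j) (epi {0} f)

-- Introspection: whatever follows from knowledge at time i is known from
-- time i + 2 on (axiom 4 to time i + 1, then timed necessitation).
K-intro : ∀ {i j A B} → suc i < j → ⊢tS4 (K i A ⇒ B) → ⊢tS4 (K i A ⇒ K j B)
K-intro {i} 1+i<j f = ax4 (n<1+n i) ⨾ K-mono f 1+i<j

K¹φ-inconsistent : (E₁ E₂ : Fm) → ⊢tS4 (K 1 (φ E₁ E₂) ⇒ ⊥′)
K¹φ-inconsistent E₁ E₂ = clash knows-E₁ ignores-E₁
  where
  H : Fm
  H = K 1 (φ E₁ E₂)

  xor : ⊢tS4 (φ E₁ E₂ ⇒ (E₁ ⊻ E₂))
  xor = ∧-fst

  clause₁ : ⊢tS4 (φ E₁ E₂ ⇒ (E₁ ⇒ ⋀ (map (λ i → ¬′ K i E₁) (upTo 10))))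
  clause₁ = ∧-snd ⨾ ∧-fst

  clause₂ : ⊢tS4 (φ E₁ E₂ ⇒ (E₂ ⇒
              (⋀ (map (λ i → ¬′ K i E₂) (upTo 20))
               ∧′ ⋀ (map (λ i → K i (¬′ E₁)) (map (11 +_) (upTo 10))))))
  clause₂ = ∧-snd ⨾ ∧-snd

  holds : ∀ {A} → ⊢tS4 (φ E₁ E₂ ⇒ A) → ⊢tS4 (H ⇒ A)
  holds f = axT ⨾ f

  knows-¬E₁⇒E₂ : ⊢tS4 (H ⇒ K 2 (¬′ E₁ ⇒ E₂))
  knows-¬E₁⇒E₂ = K-mono (xor ⨾ ⊻-resolveˡ) <-by-computation

  knows-¬E₂⇒E₁ : ⊢tS4 (H ⇒ K 2 (¬′ E₂ ⇒ E₁))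
  knows-¬E₂⇒E₁ = K-mono (xor ⨾ ⊻-resolveʳ) <-by-computation

  -- Were E₂ true, E₁ would be known false at 11, hence E₂ known at 12 ...
  E₂⇒K¹²E₂ : ⊢tS4 (H ⇒ (E₂ ⇒ K 12 E₂))
  E₂⇒K¹²E₂ =
    chain (chain (holds clause₂) (weaken (∧-snd ⨾ ⋀-elim K¹¹¬E₁∈)))
          (knows-¬E₁⇒E₂ ⨾ axK <-by-computation <-by-computation)
    where
    K¹¹¬E₁∈ : K 11 (¬′ E₁) ∈ map (λ i → K i (¬′ E₁)) (map (11 +_) (upTo 10))
    K¹¹¬E₁∈ = ∈-map⁺ (λ i → K i (¬′ E₁))
                (∈-map⁺ (11 +_) (∈-upTo⁺ <-by-computation))

  -- ... while φ says E₂ is not known at 12.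
  E₂⇒¬K¹²E₂ : ⊢tS4 (H ⇒ (E₂ ⇒ ¬′ K 12 E₂))
  E₂⇒¬K¹²E₂ = chain (holds clause₂) (weaken (∧-fst ⨾ ⋀-elim ¬K¹²E₂∈))
    where
    ¬K¹²E₂∈ : ¬′ K 12 E₂ ∈ map (λ i → ¬′ K i E₂) (upTo 20)
    ¬K¹²E₂∈ = ∈-map⁺ (λ i → ¬′ K i E₂) (∈-upTo⁺ <-by-computation)

  ¬E₂ : ⊢tS4 (H ⇒ ¬′ E₂)
  ¬E₂ = refute E₂⇒K¹²E₂ E₂⇒¬K¹²E₂

  -- By introspection ¬E₂ is known at 3, so E₁ is known at 4 ...
  knows-¬E₂ : ⊢tS4 (H ⇒ K 3 (¬′ E₂))
  knows-¬E₂ = K-intro <-by-computation ¬E₂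

  knows-E₁ : ⊢tS4 (H ⇒ K 4 E₁)
  knows-E₁ = (knows-¬E₂⇒E₁ ⨾ axK <-by-computation <-by-computation) ⊛ knows-¬E₂

  -- ... but E₁ is true, and φ then says it is not known at 4.
  E₁-holds : ⊢tS4 (H ⇒ E₁)
  E₁-holds = holds (xor ⨾ ⊻-resolveʳ) ⊛ ¬E₂

  ignores-E₁ : ⊢tS4 (H ⇒ ¬′ K 4 E₁)
  ignores-E₁ = chain (holds clause₁) (weaken (⋀-elim ¬K⁴E₁∈)) ⊛ E₁-holds
    where
    ¬K⁴E₁∈ : ¬′ K 4 E₁ ∈ map (λ i → ¬′ K i E₁) (upTo 10)
    ¬K⁴E₁∈ = ∈-map⁺ (λ i → ¬′ K i E₁) (∈-upTo⁺ <-by-computation)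

-- Theorem 35: K¹φ ⊢tS4 ⊥.
theorem35 : (e₁ e₂ : ℕ) → e₁ ≢ e₂ →
    (K 1 (φ (var e₁) (var e₂)) ∷ []) ⊢tS4 ⊥′
theorem35 e₁ e₂ _ =
  mp (thm (K¹φ-inconsistent (var e₁) (var e₂))) (hyp (here refl))
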